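{- For every $n\ge 0$, the statistics $h(P)=$ "number of occurrences of the subword $DUDD$ in $P$" and $l(P)=$ "number of occurrences of a subword of the form $DU^tDD$ with $t\ge 2$ in $P$" are equidistributed on the set of Dyck paths of semilength $n$.
   Context: A Dyck path of semilength $n$ is a word over $\{U,D\}$ with $n$ letters $U$ and $n$ letters $D$ such that every prefix has at least as many $U$'s as $D$'s. A subword is a factor of consecutive letters; an occurrence of a subword is a position at which that factor begins (for $DU^tDD$, $t\ge2$, a position at which a factor $D\,U^t\,D\,D$ with some $t\ge 2$ begins). Two statistics $h,l$ are equidistributed if $\sum_P x^{h(P)}=\sum_P x^{l(P)}$ over all Dyck paths $P$ of semilength $n$. -}

module Defs where

open import Data.Nat using (ℕ; zero; suc; _+_; _≤_; _<_; _≥_; z≤n; s≤s)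
open import Data.List using (List; []; _∷_; length; filter; map; concatMap)
open import Data.Bool using (Bool; true; false; if_then_else_)
open import Relation.Nullary using (Dec; yes; no)
open import Relation.Binary.PropositionalEquality using (_≡_)

data Step : Set where
  U D : Step

Word : Set
Word = List Step

words : ℕ → List Word
words zero    = [] ∷ []
words (suc m) = concatMap (λ w → (U ∷ w) ∷ (D ∷ w) ∷ []) (words m)

dyckFrom : ℕ → Word → Bool
dyckFrom zero    []      = true
dyckFrom (suc _) []      = false
dyckFrom h       (U ∷ w) = dyckFrom (suc h) w
dyckFrom zero    (D ∷ w) = false
dyckFrom (suc h) (D ∷ w) = dyckFrom h w

isDyck : Word → Bool
isDyck = dyckFrom zero

-- The list of Dyck paths of semilength n: words of length 2n that are Dyck
-- (a word of length 2n ending at height 0 has exactly n U's and n D's).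
dyckPaths : ℕ → List Word
dyckPaths n = filter (λ w → Data.Bool._≟_ (isDyck w) true) (words (n + n))

startsDUDD : Word → Bool
startsDUDD (D ∷ U ∷ D ∷ D ∷ _) = true
startsDUDD _                   = false

startsUsDD : Word → Bool
startsUsDD (U ∷ w)     = startsUsDD w
startsUsDD (D ∷ D ∷ _) = true
startsUsDD _           = false

startsDUtDD : Word → Bool
startsDUtDD (D ∷ U ∷ U ∷ w) = startsUsDD w
startsDUtDD _               = false

-- Number of positions i such that the suffix starting at i satisfies p,
-- i.e. the number of occurrences of a factor described by p.
occurrences : (Word → Bool) → Word → ℕ
occurrences p []          = 0
occurrences p w@(_ ∷ w′)  = (if p w then 1 else 0) + occurrences p w′

h : Word → ℕ
h = occurrences startsDUDD

l : Word → ℕ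
l = occurrences startsDUtDD

-- Number of elements of a list on which the statistic s takes value k
-- (the coefficient of x^k in Σ_P x^{s(P)}).
countWith : (Word → ℕ) → ℕ → List Word → ℕ
countWith s k ps = length (filter (λ w → Data.Nat._≟_ (s w) k) ps)

-- Read a Dyck path as a binary tree, node a b ↦ U a D b. An occurrence of DUDD or of DU^tDD
-- (t ≥ 2) starts at the D of a node and depends only on the subtree after it and on whether
-- a D follows that subtree. DUDD occurrences are the cherries (node leaf leaf) that are right
-- children not on the right spine of the whole tree. The DU^tDD occurrences of the mirrored
-- tree correspond to the nodes whose left subtree has a nonempty right subtree whose right
-- spine ends in a cherry; sending such a node to that cherry is a bijection onto the former.
-- Mirroring is an involution on Dyck paths of semilength n, so h and l are equidistributed.
module Submission where

open import Defs
open import Data.Nat using (ℕ; zero; suc; _+_; _*_; _≟_; _≡ᵇ_)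
open import Data.Nat.Properties using (+-comm; +-identityʳ)
open import Data.Nat.Tactic.RingSolver using (solve-∀)
open import Data.Bool using (Bool; true; false; if_then_else_) renaming (_≟_ to _≟ᵇ_)
open import Data.Vec using (Vec; []; _∷_; replicate; head)
open import Data.List using (List; []; _∷_; length; map; filter; concatMap)
open import Data.List.Properties using (map-∘; map-id-local; ∷-injectiveʳ)
open import Data.List.Relation.Unary.Any using (here; there)
open import Data.List.Relation.Unary.All as All using (All)
open import Data.List.Relation.Unary.AllPairs using ([]; _∷_)
open import Data.List.Relation.Unary.Unique.Propositional using (Unique)
import Data.List.Relation.Unary.Unique.Propositional.Properties as Unique
open import Data.List.Membership.Propositional using (_∈_; lose; find)
open import Data.List.Membership.Propositional.Properties
  using (∈-map⁺; ∈-map⁻; ∈-filter⁺; ∈-filter⁻; ∈-concatMap⁺; ∈-concatMap⁻)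
open import Data.List.Membership.Propositional.Properties.WithK using (unique∧set⇒bag)
open import Data.List.Relation.Binary.BagAndSetEquality using (∼bag⇒↭)
open import Data.List.Relation.Binary.Permutation.Propositional using (_↭_)
open import Data.List.Relation.Binary.Permutation.Propositional.Properties using (↭-length; filter-↭)
open import Data.Product using (_×_; _,_; proj₂)
open import Function using (_∘_)
open import Function.Bundles using (mk⇔)
open import Relation.Nullary using (Dec; does)
open import Relation.Binary.PropositionalEquality
  using (_≡_; _≢_; refl; sym; trans; cong; cong₂; subst; module ≡-Reasoning)
open ≡-Reasoning

data Tree : Set where
  leaf : Tree
  node : Tree → Tree → Tree

encodeOnto : Tree → Word → Word
encodeOnto leaf       w = w
encodeOnto (node a b) w = U ∷ encodeOnto a (D ∷ encodeOnto b w)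

encode : Tree → Word
encode t = encodeOnto t []

mirror : Tree → Tree
mirror leaf       = leaf
mirror (node a b) = node (mirror b) (mirror a)

mirror-involutive : ∀ t → mirror (mirror t) ≡ t
mirror-involutive leaf       = refl
mirror-involutive (node a b) = cong₂ node (mirror-involutive a) (mirror-involutive b)

size : Tree → ℕ
size leaf       = 0
size (node a b) = suc (size a + size b)

size-mirror : ∀ t → size (mirror t) ≡ size t
size-mirror leaf       = refl
size-mirror (node a b) = cong suc (begin
  size (mirror b) + size (mirror a) ≡⟨ cong₂ _+_ (size-mirror b) (size-mirror a) ⟩
  size b + size a                   ≡⟨ +-comm (size b) (size a) ⟩
  size a + size b                   ∎)

length-encodeOnto : ∀ t w → length (encodeOnto t w) ≡ 2 * size t + length w
length-encodeOnto leaf       w = refl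
length-encodeOnto (node a b) w = begin
  suc (length (encodeOnto a (D ∷ encodeOnto b w)))  ≡⟨ cong suc (length-encodeOnto a _) ⟩
  suc (2 * size a + suc (length (encodeOnto b w)))  ≡⟨ cong (λ m → suc (2 * size a + suc m)) (length-encodeOnto b w) ⟩
  suc (2 * size a + suc (2 * size b + length w))    ≡⟨ regroup (size a) (size b) (length w) ⟩
  2 * suc (size a + size b) + length w              ∎
  where
  regroup : ∀ x y z → suc (2 * x + suc (2 * y + z)) ≡ 2 * suc (x + y) + z
  regroup = solve-∀

dyckFrom-U : ∀ k w → dyckFrom k (U ∷ w) ≡ dyckFrom (suc k) w
dyckFrom-U zero    w = refl
dyckFrom-U (suc k) w = refl

dyckFrom-encodeOnto : ∀ t k w → dyckFrom k (encodeOnto t w) ≡ dyckFrom k w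
dyckFrom-encodeOnto leaf       k w = refl
dyckFrom-encodeOnto (node a b) k w = begin
  dyckFrom k (U ∷ encodeOnto a (D ∷ encodeOnto b w))  ≡⟨ dyckFrom-U k _ ⟩
  dyckFrom (suc k) (encodeOnto a (D ∷ encodeOnto b w)) ≡⟨ dyckFrom-encodeOnto a (suc k) _ ⟩
  dyckFrom k (encodeOnto b w)                          ≡⟨ dyckFrom-encodeOnto b k w ⟩
  dyckFrom k w                                         ∎

isDyck-encode : ∀ t → isDyck (encode t) ≡ true
isDyck-encode t = dyckFrom-encodeOnto t 0 []

graft : ∀ {k} → Vec Tree (suc (suc k)) → Vec Tree (suc k)
graft (a ∷ b ∷ ts) = node a b ∷ ts

-- parseFrom k reads a path from height k down to 0 as t₀ D t₁ D … D t_k (see encodeForest).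
-- The clauses for [] at positive height and for D at height 0 only serve non-Dyck input.
parseFrom : (k : ℕ) → Word → Vec Tree (suc k)
parseFrom k       (U ∷ w) = graft (parseFrom (suc k) w)
parseFrom zero    []      = leaf ∷ []
parseFrom (suc k) []      = replicate _ leaf
parseFrom zero    (D ∷ w) = leaf ∷ []
parseFrom (suc k) (D ∷ w) = leaf ∷ parseFrom k w

parse : Word → Tree
parse w = head (parseFrom 0 w)

encodeSeparated : ∀ {k} → Vec Tree k → Word
encodeSeparated []       = []
encodeSeparated (t ∷ ts) = D ∷ encodeOnto t (encodeSeparated ts)

encodeForest : ∀ {k} → Vec Tree (suc k) → Word
encodeForest (t ∷ ts) = encodeOnto t (encodeSeparated ts)

encodeForest-graft : ∀ {k} (ts : Vec Tree (suc (suc k))) → encodeForest (graft ts) ≡ U ∷ encodeForest ts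
encodeForest-graft (a ∷ b ∷ ts) = refl

encodeForest-parseFrom : ∀ k w → dyckFrom k w ≡ true → encodeForest (parseFrom k w) ≡ w
encodeForest-parseFrom k (U ∷ w) dyck = begin
  encodeForest (graft (parseFrom (suc k) w)) ≡⟨ encodeForest-graft (parseFrom (suc k) w) ⟩
  U ∷ encodeForest (parseFrom (suc k) w)     ≡⟨ cong (U ∷_) (encodeForest-parseFrom (suc k) w
                                                   (trans (sym (dyckFrom-U k w)) dyck)) ⟩
  U ∷ w                                      ∎
encodeForest-parseFrom zero    []      dyck = refl
encodeForest-parseFrom (suc k) (D ∷ w) dyck with parseFrom k w | encodeForest-parseFrom k w dyck
... | t ∷ ts | encoded = cong (D ∷_) encoded

parseFrom-encodeOnto : ∀ t {k} w ts → parseFrom k w ≡ leaf ∷ ts → parseFrom k (encodeOnto t w) ≡ t ∷ ts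
parseFrom-encodeOnto leaf       w ts parsed = parsed
parseFrom-encodeOnto (node a b) {k} w ts parsed
  rewrite parseFrom-encodeOnto a {suc k} (D ∷ encodeOnto b w) (b ∷ ts)
            (cong (leaf ∷_) (parseFrom-encodeOnto b w ts parsed)) = refl

parse-encode : ∀ t → parse (encode t) ≡ t
parse-encode t = cong head (parseFrom-encodeOnto t [] [] refl)

encode-parse : ∀ w → isDyck w ≡ true → encode (parse w) ≡ w
encode-parse w dyck with parseFrom 0 w | encodeForest-parseFrom 0 w dyck
... | t ∷ [] | encoded = encoded

-- A factor starting with D, at the D of a node a b, only sees b and whether a D follows b;
-- nodeSum s f t adds up s over the nodes of t, where t is followed by a D iff f.
data Followed : Bool → Word → Set where
  end  : Followed false []
  down : ∀ w → Followed true (D ∷ w)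

indicator : Bool → ℕ
indicator b = if b then 1 else 0

nodeSum : (Bool → Tree → ℕ) → Bool → Tree → ℕ
nodeSum s f leaf       = 0
nodeSum s f (node a b) = nodeSum s true a + (s f b + nodeSum s f b)

occurrences-encodeOnto : ∀ (p : Word → Bool) (s : Bool → Tree → ℕ) →
  (∀ w → p (U ∷ w) ≡ false) →
  (∀ b {f w} → Followed f w → indicator (p (D ∷ encodeOnto b w)) ≡ s f b) →
  ∀ t {f w} → Followed f w → occurrences p (encodeOnto t w) ≡ nodeSum s f t + occurrences p w
occurrences-encodeOnto p s notAtU atD leaf       followed = refl
occurrences-encodeOnto p s notAtU atD (node a b) {f} {w} followed = begin
  indicator (p (U ∷ rest)) + occurrences p rest
    ≡⟨ cong (λ c → indicator c + occurrences p rest) (notAtU rest) ⟩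
  occurrences p (encodeOnto a (D ∷ encodeOnto b w))
    ≡⟨ occurrences-encodeOnto p s notAtU atD a (down _) ⟩
  nodeSum s true a + (indicator (p (D ∷ encodeOnto b w)) + occurrences p (encodeOnto b w))
    ≡⟨ cong (nodeSum s true a +_) (cong₂ _+_ (atD b followed)
                                             (occurrences-encodeOnto p s notAtU atD b followed)) ⟩
  nodeSum s true a + (s f b + (nodeSum s f b + occurrences p w))
    ≡⟨ regroup (nodeSum s true a) (s f b) (nodeSum s f b) (occurrences p w) ⟩
  nodeSum s true a + (s f b + nodeSum s f b) + occurrences p w
    ∎
  where
  rest = encodeOnto a (D ∷ encodeOnto b w)
  regroup : ∀ x y z u → x + (y + (z + u)) ≡ x + (y + z) + u
  regroup = solve-∀

occurrences-encode : ∀ (p : Word → Bool) (s : Bool → Tree → ℕ) →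
  (∀ w → p (U ∷ w) ≡ false) →
  (∀ b {f w} → Followed f w → indicator (p (D ∷ encodeOnto b w)) ≡ s f b) →
  ∀ t → occurrences p (encode t) ≡ nodeSum s false t
occurrences-encode p s notAtU atD t =
  trans (occurrences-encodeOnto p s notAtU atD t end) (+-identityʳ (nodeSum s false t))

isLeaf : Tree → ℕ
isLeaf leaf       = 1
isLeaf (node _ _) = 0

isCherry : Tree → ℕ
isCherry leaf                = 0
isCherry (node a leaf)       = isLeaf a
isCherry (node _ (node _ _)) = 0

leftmostCherry : Tree → ℕ
leftmostCherry leaf                = 0
leftmostCherry (node leaf b)       = isLeaf b
leftmostCherry (node (node a b) _) = leftmostCherry (node a b)

rightmostCherry : Tree → ℕ
rightmostCherry leaf                = 0
rightmostCherry (node a leaf)       = isLeaf a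
rightmostCherry (node _ (node a b)) = rightmostCherry (node a b)

leftChild : Tree → Tree
leftChild leaf       = leaf
leftChild (node a _) = a

rightChild : Tree → Tree
rightChild leaf       = leaf
rightChild (node _ b) = b

duddAt : Bool → Tree → ℕ
duddAt f b = if f then isCherry b else 0

dutddAt : Bool → Tree → ℕ
dutddAt _ b = leftmostCherry (leftChild b)

startsDUDD-encodeOnto : ∀ b {f w} → Followed f w →
  indicator (startsDUDD (D ∷ encodeOnto b w)) ≡ duddAt f b
startsDUDD-encodeOnto leaf                         end      = refl
startsDUDD-encodeOnto leaf                         (down _) = refl
startsDUDD-encodeOnto (node leaf leaf)             end      = refl
startsDUDD-encodeOnto (node leaf leaf)             (down _) = refl
startsDUDD-encodeOnto (node leaf (node _ _))       end      = refl
startsDUDD-encodeOnto (node leaf (node _ _))       (down _) = refl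
startsDUDD-encodeOnto (node (node _ _) leaf)       end      = refl
startsDUDD-encodeOnto (node (node _ _) leaf)       (down _) = refl
startsDUDD-encodeOnto (node (node _ _) (node _ _)) end      = refl
startsDUDD-encodeOnto (node (node _ _) (node _ _)) (down _) = refl

startsUsDD-encodeOnto : ∀ a b w →
  indicator (startsUsDD (encodeOnto a (D ∷ encodeOnto b (D ∷ w)))) ≡ leftmostCherry (node a b)
startsUsDD-encodeOnto leaf         leaf       w = refl
startsUsDD-encodeOnto leaf         (node _ _) w = refl
startsUsDD-encodeOnto (node a₁ a₂) b          w = startsUsDD-encodeOnto a₁ a₂ (encodeOnto b (D ∷ w))

startsDUtDD-encodeOnto : ∀ b {f w} → Followed f w →
  indicator (startsDUtDD (D ∷ encodeOnto b w)) ≡ dutddAt f b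
startsDUtDD-encodeOnto leaf                  end         = refl
startsDUtDD-encodeOnto leaf                  (down _)    = refl
startsDUtDD-encodeOnto (node leaf _)         _           = refl
startsDUtDD-encodeOnto (node (node a₁ a₂) b) {w = w} _ = startsUsDD-encodeOnto a₁ a₂ (encodeOnto b w)

leftmostCherry-mirror : ∀ t → leftmostCherry (mirror t) ≡ rightmostCherry t
leftmostCherry-mirror leaf                   = refl
leftmostCherry-mirror (node leaf leaf)       = refl
leftmostCherry-mirror (node (node _ _) leaf) = refl
leftmostCherry-mirror (node _ (node a b))    = leftmostCherry-mirror (node a b)

dutddAt-mirror : ∀ f t → dutddAt f (mirror t) ≡ rightmostCherry (rightChild t)
dutddAt-mirror f leaf       = refl
dutddAt-mirror f (node _ b) = leftmostCherry-mirror b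

isCherry+rightmostCherry : ∀ a b → isCherry (node a b) + rightmostCherry b ≡ rightmostCherry (node a b)
isCherry+rightmostCherry a leaf       = +-identityʳ (isLeaf a)
isCherry+rightmostCherry a (node _ _) = refl

nodeSum-duddAt-followed : ∀ t → nodeSum duddAt true t ≡ nodeSum duddAt false t + rightmostCherry (rightChild t)
nodeSum-duddAt-followed leaf = refl
nodeSum-duddAt-followed (node a leaf) = sym (+-identityʳ (nodeSum duddAt true a + 0))
nodeSum-duddAt-followed (node a b@(node c d)) = begin
  x + (isCherry b + nodeSum duddAt true b)         ≡⟨ cong (λ m → x + (isCherry b + m)) (nodeSum-duddAt-followed b) ⟩
  x + (isCherry b + (y + rightmostCherry d))       ≡⟨ regroup x (isCherry b) y (rightmostCherry d) ⟩
  x + y + (isCherry b + rightmostCherry d)         ≡⟨ cong (x + y +_) (isCherry+rightmostCherry c d) ⟩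
  x + y + rightmostCherry b                        ∎
  where
  x = nodeSum duddAt true a
  y = nodeSum duddAt false b
  regroup : ∀ x i y r → x + (i + (y + r)) ≡ x + y + (i + r)
  regroup = solve-∀

nodeSum-dutddAt-mirror : ∀ f t → nodeSum dutddAt f (mirror t) ≡ nodeSum duddAt false t
nodeSum-dutddAt-mirror f leaf       = refl
nodeSum-dutddAt-mirror f (node a b) = begin
  nodeSum dutddAt true (mirror b) + (dutddAt f (mirror a) + nodeSum dutddAt f (mirror a))
    ≡⟨ cong₂ _+_ (nodeSum-dutddAt-mirror true b)
                 (cong₂ _+_ (dutddAt-mirror f a) (nodeSum-dutddAt-mirror f a)) ⟩
  y + (rightmostCherry (rightChild a) + x)
    ≡⟨ regroup y (rightmostCherry (rightChild a)) x ⟩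
  x + rightmostCherry (rightChild a) + y
    ≡⟨ cong (_+ y) (sym (nodeSum-duddAt-followed a)) ⟩
  nodeSum duddAt true a + y
    ∎
  where
  x = nodeSum duddAt false a
  y = nodeSum duddAt false b
  regroup : ∀ y r x → y + (r + x) ≡ x + r + y
  regroup = solve-∀

h-encode≡l-encode-mirror : ∀ t → h (encode t) ≡ l (encode (mirror t))
h-encode≡l-encode-mirror t = begin
  h (encode t)                       ≡⟨ occurrences-encode startsDUDD duddAt (λ _ → refl) startsDUDD-encodeOnto t ⟩
  nodeSum duddAt false t             ≡⟨ sym (nodeSum-dutddAt-mirror false t) ⟩
  nodeSum dutddAt false (mirror t)   ≡⟨ sym (occurrences-encode startsDUtDD dutddAt (λ _ → refl) startsDUtDD-encodeOnto (mirror t)) ⟩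
  l (encode (mirror t))              ∎

prependStep : Word → List Word
prependStep w = (U ∷ w) ∷ (D ∷ w) ∷ []

∈-words⁻ : ∀ m {w} → w ∈ words m → length w ≡ m
∈-words⁻ zero    (here refl) = refl
∈-words⁻ (suc m) w∈ with find (∈-concatMap⁻ prependStep {xs = words m} w∈)
... | v , v∈ , here refl         = cong suc (∈-words⁻ m v∈)
... | v , v∈ , there (here refl) = cong suc (∈-words⁻ m v∈)

∈-words⁺ : ∀ w → w ∈ words (length w)
∈-words⁺ []      = here refl
∈-words⁺ (U ∷ w) = ∈-concatMap⁺ prependStep (lose (∈-words⁺ w) (here refl))
∈-words⁺ (D ∷ w) = ∈-concatMap⁺ prependStep (lose (∈-words⁺ w) (there (here refl)))

words-unique : ∀ m → Unique (words m)
words-unique zero    = All.[] ∷ []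
words-unique (suc m) = prepend-unique (words-unique m)
  where
  prepend-distinct : ∀ {w ws} s → All (w ≢_) ws → All (s ∷ w ≢_) (concatMap prependStep ws)
  prepend-distinct {w} {ws} s w∉ = All.tabulate distinct
    where
    distinct : ∀ {x} → x ∈ concatMap prependStep ws → s ∷ w ≢ x
    distinct x∈ eq with find (∈-concatMap⁻ prependStep {xs = ws} x∈)
    ... | u , u∈ , here refl         = All.lookup w∉ u∈ (∷-injectiveʳ eq)
    ... | u , u∈ , there (here refl) = All.lookup w∉ u∈ (∷-injectiveʳ eq)
  prepend-unique : ∀ {ws} → Unique ws → Unique (concatMap prependStep ws)
  prepend-unique []           = []
  prepend-unique (w∉ ∷ uniq) =
    ((λ ()) All.∷ prepend-distinct U w∉) ∷ prepend-distinct D w∉ ∷ prepend-unique uniq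

isDyck? : (w : Word) → Dec (isDyck w ≡ true)
isDyck? w = isDyck w ≟ᵇ true

∈-dyckPaths⁻ : ∀ n {w} → w ∈ dyckPaths n → length w ≡ n + n × isDyck w ≡ true
∈-dyckPaths⁻ n w∈ with ∈-filter⁻ isDyck? {xs = words (n + n)} w∈
... | w∈words , dyck = ∈-words⁻ (n + n) w∈words , dyck

∈-dyckPaths⁺ : ∀ n {w} → length w ≡ n + n → isDyck w ≡ true → w ∈ dyckPaths n
∈-dyckPaths⁺ n {w} len dyck = ∈-filter⁺ isDyck? (subst (λ m → w ∈ words m) len (∈-words⁺ w)) dyck

dyckPaths-unique : ∀ n → Unique (dyckPaths n)
dyckPaths-unique n = Unique.filter⁺ isDyck? (words-unique (n + n))

mirrorPath : Word → Word
mirrorPath = encode ∘ mirror ∘ parse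

module _ {w : Word} (dyck : isDyck w ≡ true) where

  mirrorPath-involutive : mirrorPath (mirrorPath w) ≡ w
  mirrorPath-involutive = begin
    encode (mirror (parse (encode (mirror (parse w))))) ≡⟨ cong (encode ∘ mirror) (parse-encode _) ⟩
    encode (mirror (mirror (parse w)))                  ≡⟨ cong encode (mirror-involutive _) ⟩
    encode (parse w)                                    ≡⟨ encode-parse w dyck ⟩
    w                                                   ∎

  length-mirrorPath : length (mirrorPath w) ≡ length w
  length-mirrorPath = begin
    length (encode (mirror (parse w))) ≡⟨ length-encodeOnto (mirror (parse w)) [] ⟩
    2 * size (mirror (parse w)) + 0    ≡⟨ cong (λ m → 2 * m + 0) (size-mirror (parse w)) ⟩
    2 * size (parse w) + 0             ≡⟨ sym (length-encodeOnto (parse w) []) ⟩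
    length (encode (parse w))          ≡⟨ cong length (encode-parse w dyck) ⟩
    length w                           ∎

  h≡l∘mirrorPath : h w ≡ l (mirrorPath w)
  h≡l∘mirrorPath = trans (cong h (sym (encode-parse w dyck))) (h-encode≡l-encode-mirror (parse w))

mirrorPath-∈ : ∀ n {w} → w ∈ dyckPaths n → mirrorPath w ∈ dyckPaths n
mirrorPath-∈ n {w} w∈ with ∈-dyckPaths⁻ n w∈
... | len , dyck = ∈-dyckPaths⁺ n (trans (length-mirrorPath {w} dyck) len) (isDyck-encode (mirror (parse w)))

involution⇒map-↭ : ∀ {A : Set} (f : A → A) {xs : List A} → Unique xs →
  (∀ {x} → x ∈ xs → f x ∈ xs) → (∀ {x} → x ∈ xs → f (f x) ≡ x) → map f xs ↭ xs
involution⇒map-↭ f {xs} uniq closed involutive =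
  ∼bag⇒↭ (unique∧set⇒bag mapped-unique uniq (mk⇔ into onto))
  where
  map-map≡id : map f (map f xs) ≡ xs
  map-map≡id = trans (sym (map-∘ xs)) (map-id-local (All.tabulate involutive))
  mapped-unique : Unique (map f xs)
  mapped-unique = Unique.map⁻ (subst Unique (sym map-map≡id) uniq)
  into : ∀ {x} → x ∈ map f xs → x ∈ xs
  into x∈ with ∈-map⁻ f x∈
  ... | y , y∈ , refl = closed y∈
  onto : ∀ {x} → x ∈ xs → x ∈ map f xs
  onto x∈ = subst (_∈ map f xs) (involutive x∈) (∈-map⁺ f (closed x∈))

-- does (m ≟ k) computes to m ≡ᵇ k, on which both sides are stuck.
countWith-∷ : ∀ (s : Word → ℕ) k x xs →
  countWith s k (x ∷ xs) ≡ indicator (does (s x ≟ k)) + countWith s k xs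
countWith-∷ s k x xs with s x ≡ᵇ k
... | true  = refl
... | false = refl

countWith-map : ∀ {s t : Word → ℕ} (f : Word → Word) k {xs} →
  (∀ {x} → x ∈ xs → s x ≡ t (f x)) → countWith s k xs ≡ countWith t k (map f xs)
countWith-map         f k {[]}     agree = refl
countWith-map {s} {t} f k {x ∷ xs} agree = begin
  countWith s k (x ∷ xs)
    ≡⟨ countWith-∷ s k x xs ⟩
  indicator (does (s x ≟ k)) + countWith s k xs
    ≡⟨ cong₂ _+_ (cong (λ m → indicator (does (m ≟ k))) (agree (here refl)))
                 (countWith-map f k (agree ∘ there)) ⟩
  indicator (does (t (f x) ≟ k)) + countWith t k (map f xs)
    ≡⟨ countWith-∷ t k (f x) (map f xs) ⟨
  countWith t k (f x ∷ map f xs)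
    ∎

proposition11 : (n k : ℕ) → countWith h k (dyckPaths n) ≡ countWith l k (dyckPaths n)
proposition11 n k = begin
  countWith h k (dyckPaths n)                  ≡⟨ countWith-map mirrorPath k (λ {w} w∈ → h≡l∘mirrorPath {w} (dyck w∈)) ⟩
  countWith l k (map mirrorPath (dyckPaths n)) ≡⟨ ↭-length (filter-↭ (λ w → l w ≟ k) mirrorPath-↭) ⟩
  countWith l k (dyckPaths n)                  ∎
  where
  dyck : ∀ {w} → w ∈ dyckPaths n → isDyck w ≡ true
  dyck = proj₂ ∘ ∈-dyckPaths⁻ n
  mirrorPath-↭ : map mirrorPath (dyckPaths n) ↭ dyckPaths n
  mirrorPath-↭ = involution⇒map-↭ mirrorPath (dyckPaths-unique n) (mirrorPath-∈ n)
                   (λ {w} w∈ → mirrorPath-involutive {w} (dyck w∈))
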